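{- Let $n_1,n_2,n_3\ge 2$ and let $G=P_{n_1}\Box P_{n_2}\Box P_{n_3}$. Then $\dim(G)=3$. Moreover, any set formed by three corners of a face of $G$ is a metric basis of $G$.
   Context: $P_{n_1}\Box P_{n_2}\Box P_{n_3}$ is the cartesian product of paths, with vertex set $\{(x_1,x_2,x_3): 0\le x_i\le n_i-1\}$, two vertices being adjacent iff they differ by exactly $1$ in exactly one coordinate; hence $d((x_1,x_2,x_3),(y_1,y_2,y_3))=\sum_i|x_i-y_i|$. A vertex $w$ resolves vertices $x,y$ if $d(w,x)\ne d(w,y)$. A set $S$ of vertices is a resolving set if every pair of distinct vertices is resolved by some vertex of $S$; $\dim(G)$ (the metric dimension) is the minimum cardinality of a resolving set, and a metric basis is a resolving set of that cardinality. Corners are the vertices of degree 3, i.e. those with $x_i\in\{0,n_i-1\}$ for all $i$. A face is the set of vertices with $x_{i_0}$ equal to a fixed value in $\{0,n_{i_0}-1\}$ for some $i_0\in\{1,2,3\}$. -}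

module Defs where

open import Data.Nat using (ℕ; zero; suc; _+_; _≤_; ∣_-_∣; _∸_)
open import Data.Fin using (Fin; toℕ)
open import Data.Product using (_×_; _,_; ∃-syntax; Σ-syntax)
open import Data.Sum using (_⊎_)
open import Data.List using (List; length; _∷_; [])
open import Data.List.Membership.Propositional using (_∈_)
open import Data.List.Relation.Unary.Unique.Propositional using (Unique)
open import Relation.Binary.PropositionalEquality using (_≡_; _≢_)

Vertex : ℕ → ℕ → ℕ → Set
Vertex n₁ n₂ n₃ = Fin n₁ × Fin n₂ × Fin n₃

dist : ∀ {n₁ n₂ n₃} → Vertex n₁ n₂ n₃ → Vertex n₁ n₂ n₃ → ℕ
dist (x₁ , x₂ , x₃) (y₁ , y₂ , y₃) =
  ∣ toℕ x₁ - toℕ y₁ ∣ + ∣ toℕ x₂ - toℕ y₂ ∣ + ∣ toℕ x₃ - toℕ y₃ ∣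

Resolves : ∀ {n₁ n₂ n₃} → Vertex n₁ n₂ n₃ → Vertex n₁ n₂ n₃ → Vertex n₁ n₂ n₃ → Set
Resolves w x y = dist w x ≢ dist w y

IsResolving : ∀ {n₁ n₂ n₃} → List (Vertex n₁ n₂ n₃) → Set
IsResolving {n₁} {n₂} {n₃} S =
  (x y : Vertex n₁ n₂ n₃) → x ≢ y → ∃[ w ] (w ∈ S × Resolves w x y)

MetricDimensionIs : ℕ → ℕ → ℕ → ℕ → Set
MetricDimensionIs n₁ n₂ n₃ k =
  (Σ[ S ∈ List (Vertex n₁ n₂ n₃) ] (Unique S × IsResolving S × length S ≡ k))
  × ((S : List (Vertex n₁ n₂ n₃)) → Unique S → IsResolving S → k ≤ length S)

IsMetricBasis : ∀ {n₁ n₂ n₃} → List (Vertex n₁ n₂ n₃) → Set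
IsMetricBasis {n₁} {n₂} {n₃} S =
  Unique S × IsResolving S × MetricDimensionIs n₁ n₂ n₃ (length S)

Extreme : ∀ {n} → Fin n → Set
Extreme {n} x = (toℕ x ≡ 0) ⊎ (toℕ x ≡ n ∸ 1)

-- Corners: all coordinates extreme (degree-3 vertices when all n_i ≥ 2).
IsCorner : ∀ {n₁ n₂ n₃} → Vertex n₁ n₂ n₃ → Set
IsCorner (x₁ , x₂ , x₃) = Extreme x₁ × Extreme x₂ × Extreme x₃

data Coord : Set where
  c₁ c₂ c₃ : Coord

coord : ∀ {n₁ n₂ n₃} → Coord → Vertex n₁ n₂ n₃ → ℕ
coord c₁ (x₁ , _ , _) = toℕ x₁
coord c₂ (_ , x₂ , _) = toℕ x₂
coord c₃ (_ , _ , x₃) = toℕ x₃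

bound : ℕ → ℕ → ℕ → Coord → ℕ
bound n₁ _ _ c₁ = n₁
bound _ n₂ _ c₂ = n₂
bound _ _ n₃ c₃ = n₃

-- A face: fixed coordinate i₀ and fixed extreme value a ∈ {0, n_{i₀}-1}.
-- v lies on face (i₀, a) iff its i₀-th coordinate equals a.
FaceValue : ℕ → ℕ → ℕ → Coord → ℕ → Set
FaceValue n₁ n₂ n₃ i a = (a ≡ 0) ⊎ (a ≡ bound n₁ n₂ n₃ i ∸ 1)

OnFace : ∀ {n₁ n₂ n₃} → Coord → ℕ → Vertex n₁ n₂ n₃ → Set
OnFace i a v = coord i v ≡ a

-- Let u, v, w be three corners of a face x_i = a.  In each direction k of the face,
-- two of them form an opposite pair p, q: equal off k and at the two ends of the k-path.  As
-- ∣p_k - t∣ + ∣q_k - t∣ = n_k - 1 for every t, adding d(p,x) = d(p,y) and d(q,x) = d(q,y)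
-- shows that x and y have the same distance to p off k, hence the same k-coordinate; the
-- i-coordinate then follows from d(u,x) = d(u,y).
--
-- Two vertices never resolve.  Seen from a vertex a, the unit step e_l out of the origin
-- changes the distance by +1 if a_l = 0 and by -1 otherwise.  So a confuses e_j with e_k when
-- it gives directions j and k the same sign, and e_j + e_k with the origin otherwise.  Among
-- three directions two have the same relative sign for both a and b, so one of these pairs is
-- resolved by neither.
module Submission where

open import Defs
open import Data.Bool using (Bool; true; false; not; _xor_)
open import Data.Bool.Properties using (not-injective; not-involutive)
open import Data.Empty using (⊥-elim)
open import Data.Fin using (Fin; toℕ; fromℕ) renaming (zero to fzero; suc to fsuc)
open import Data.Fin.Properties using (toℕ-injective; toℕ≤pred[n]; toℕ-fromℕ)
open import Data.List using (List; []; _∷_; length)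
open import Data.List.Membership.Propositional using (_∈_; find)
open import Data.List.Relation.Binary.Subset.Propositional using (_⊆_)
open import Data.List.Relation.Unary.All using (All; []; _∷_; all?; lookup)
open import Data.List.Relation.Unary.All.Properties using (¬All⇒Any¬)
open import Data.List.Relation.Unary.AllPairs using ([]; _∷_)
open import Data.List.Relation.Unary.Any using (here; there)
open import Data.List.Relation.Unary.Unique.Propositional using (Unique)
open import Data.Nat using (ℕ; zero; suc; _+_; _∸_; _≤_; _≥_; ∣_-_∣; z≤n; s≤s; _≟_; _≡ᵇ_)
open import Data.Nat.Properties
open import Algebra.Properties.CommutativeSemigroup +-commutativeSemigroup
  using (interchange; xy∙z≈y∙zx)
open import Data.Product using (_×_; _,_; ∃-syntax; ∃₂)
open import Data.Sum using (_⊎_; inj₁; inj₂)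
open import Relation.Binary.PropositionalEquality
open import Relation.Nullary using (¬_; yes; no)

IsEnd : ℕ → ℕ → Set
IsEnd N a = a ≡ 0 ⊎ a ≡ N

end-pigeonhole : ∀ {N a b c} → IsEnd N a → IsEnd N b → IsEnd N c → a ≡ b ⊎ a ≡ c ⊎ b ≡ c
end-pigeonhole (inj₁ refl) (inj₁ refl) _           = inj₁ refl
end-pigeonhole (inj₂ refl) (inj₂ refl) _           = inj₁ refl
end-pigeonhole (inj₁ refl) (inj₂ refl) (inj₁ refl) = inj₂ (inj₁ refl)
end-pigeonhole (inj₁ refl) (inj₂ refl) (inj₂ refl) = inj₂ (inj₂ refl)
end-pigeonhole (inj₂ refl) (inj₁ refl) (inj₁ refl) = inj₂ (inj₂ refl)
end-pigeonhole (inj₂ refl) (inj₁ refl) (inj₂ refl) = inj₂ (inj₁ refl)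

∣end-∣-injective : ∀ {N p x y} → IsEnd N p → x ≤ N → y ≤ N → ∣ p - x ∣ ≡ ∣ p - y ∣ → x ≡ y
∣end-∣-injective (inj₁ refl) _   _   e = e
∣end-∣-injective (inj₂ refl) x≤N y≤N e =
  ∸-cancelˡ-≡ x≤N y≤N (trans (sym (m≤n⇒∣n-m∣≡n∸m x≤N)) (trans e (m≤n⇒∣n-m∣≡n∸m y≤N)))

opposite-ends-sum : ∀ {N p q t} → IsEnd N p → IsEnd N q → p ≢ q → t ≤ N →
  ∣ p - t ∣ + ∣ q - t ∣ ≡ N
opposite-ends-sum (inj₁ refl) (inj₁ refl) p≢q _ = ⊥-elim (p≢q refl)
opposite-ends-sum {t = t} (inj₁ refl) (inj₂ refl) _ t≤N =
  trans (cong (t +_) (m≤n⇒∣n-m∣≡n∸m t≤N)) (m+[n∸m]≡n t≤N)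
opposite-ends-sum {t = t} (inj₂ refl) (inj₁ refl) _ t≤N =
  trans (cong (_+ t) (m≤n⇒∣n-m∣≡n∸m t≤N)) (m∸n+n≡m t≤N)
opposite-ends-sum (inj₂ refl) (inj₂ refl) p≢q _ = ⊥-elim (p≢q refl)

double-injective : ∀ r s → r + r ≡ s + s → r ≡ s
double-injective zero    zero    _ = refl
double-injective (suc r) (suc s) e =
  cong suc (double-injective r s (suc-injective (begin
    suc (r + r)  ≡⟨ +-suc r r ⟨
    r + suc r    ≡⟨ suc-injective e ⟩
    s + suc s    ≡⟨ +-suc s s ⟩
    suc (s + s)  ∎)))
  where open ≡-Reasoning

≡-by-common-shift : ∀ {A A′ B B′ r s} → A + r ≡ B + s → A′ + r ≡ B′ + s → A + A′ ≡ B + B′ → A ≡ B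
≡-by-common-shift {A} {A′} {B} {B′} {r} {s} e e′ sum =
  +-cancelʳ-≡ r A B (trans e (cong (B +_) (sym r≡s)))
  where
  open ≡-Reasoning
  r≡s : r ≡ s
  r≡s = double-injective r s (+-cancelˡ-≡ (A + A′) _ _ (begin
    (A + A′) + (r + r)  ≡⟨ interchange A A′ r r ⟩
    (A + r) + (A′ + r)  ≡⟨ cong₂ _+_ e e′ ⟩
    (B + s) + (B′ + s)  ≡⟨ interchange B s B′ s ⟩
    (B + B′) + (s + s)  ≡⟨ cong (_+ (s + s)) sum ⟨
    (A + A′) + (s + s)  ∎))

swap-unit-same : ∀ a b → (a ≡ᵇ 0) ≡ (b ≡ᵇ 0) → ∣ a - 1 ∣ + ∣ b - 0 ∣ ≡ ∣ a - 0 ∣ + ∣ b - 1 ∣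
swap-unit-same zero    zero    _ = refl
swap-unit-same (suc a) (suc b) _ rewrite ∣-∣-identityʳ a | ∣-∣-identityʳ b = +-suc a b

swap-unit-opposite : ∀ a b → (a ≡ᵇ 0) ≡ not (b ≡ᵇ 0) → ∣ a - 1 ∣ + ∣ b - 1 ∣ ≡ ∣ a - 0 ∣ + ∣ b - 0 ∣
swap-unit-opposite zero    (suc b) _ = cong suc (∣-∣-identityʳ b)
swap-unit-opposite (suc a) zero    _ rewrite ∣-∣-identityʳ a | +-identityʳ a = +-comm a 1

xor-agree : ∀ p p′ q q′ → p xor p′ ≡ q xor q′ → (p ≡ q × p′ ≡ q′) ⊎ (p ≡ not q × p′ ≡ not q′)
xor-agree false p′ false q′ e = inj₁ (refl , e)
xor-agree true  p′ true  q′ e = inj₁ (refl , not-injective e)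
xor-agree false p′ true  q′ e = inj₂ (refl , e)
xor-agree true  p′ false q′ e = inj₂ (refl , trans (sym (not-involutive p′)) (cong not e))

next : Coord → Coord
next c₁ = c₂
next c₂ = c₃
next c₃ = c₁

next≢ : ∀ k → next k ≢ k
next≢ c₁ ()
next≢ c₂ ()
next≢ c₃ ()

next²≢ : ∀ k → next (next k) ≢ k
next²≢ c₁ ()
next²≢ c₂ ()
next²≢ c₃ ()

Covers : Coord → Coord → Coord → Set
Covers i j k = ∀ l → l ≡ i ⊎ l ≡ j ⊎ l ≡ k

covers-swap : ∀ {i j k} → Covers i j k → Covers i k j
covers-swap cover l with cover l
... | inj₁ l≡i        = inj₁ l≡i
... | inj₂ (inj₁ l≡j) = inj₂ (inj₂ l≡j)
... | inj₂ (inj₂ l≡k) = inj₂ (inj₁ l≡k)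

next-covers : ∀ i → Covers i (next i) (next (next i))
next-covers c₁ c₁ = inj₁ refl
next-covers c₁ c₂ = inj₂ (inj₁ refl)
next-covers c₁ c₃ = inj₂ (inj₂ refl)
next-covers c₂ c₁ = inj₂ (inj₂ refl)
next-covers c₂ c₂ = inj₁ refl
next-covers c₂ c₃ = inj₂ (inj₁ refl)
next-covers c₃ c₁ = inj₂ (inj₁ refl)
next-covers c₃ c₂ = inj₂ (inj₂ refl)
next-covers c₃ c₃ = inj₁ refl

bool-pigeonhole : ∀ (p q r : Bool) → p ≡ q ⊎ p ≡ r ⊎ q ≡ r
bool-pigeonhole false false _     = inj₁ refl
bool-pigeonhole true  true  _     = inj₁ refl
bool-pigeonhole false true  false = inj₂ (inj₁ refl)
bool-pigeonhole true  false true  = inj₂ (inj₁ refl)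
bool-pigeonhole false true  true  = inj₂ (inj₂ refl)
bool-pigeonhole true  false false = inj₂ (inj₂ refl)

adjacent-pigeonhole : (f : Coord → Bool) → ∃[ i ] f (next i) ≡ f (next (next i))
adjacent-pigeonhole f with bool-pigeonhole (f c₁) (f c₂) (f c₃)
... | inj₁ e        = c₃ , e
... | inj₂ (inj₁ e) = c₂ , sym e
... | inj₂ (inj₂ e) = c₁ , e

toℕ≤n∸1 : ∀ {n} (x : Fin n) → toℕ x ≤ n ∸ 1
toℕ≤n∸1 {suc n} x = toℕ≤pred[n] x

unique-triple : ∀ {A : Set} {u v w : A} → u ≢ v → u ≢ w → v ≢ w → Unique (u ∷ v ∷ w ∷ [])
unique-triple u≢v u≢w v≢w = (u≢v ∷ u≢w ∷ []) ∷ (v≢w ∷ []) ∷ [] ∷ []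

module _ {n₁ n₂ n₃ : ℕ} where

  private
    V : Set
    V = Vertex n₁ n₂ n₃

    maxCoord : Coord → ℕ
    maxCoord k = bound n₁ n₂ n₃ k ∸ 1

  AgreeOff : Coord → V → V → Set
  AgreeOff k p q = ∀ l → l ≢ k → coord l p ≡ coord l q

  Unresolved : List V → V → V → Set
  Unresolved S x y = All (λ w → dist w x ≡ dist w y) S

  coord≤ : ∀ l (x : V) → coord l x ≤ maxCoord l
  coord≤ c₁ (x₁ , _ , _) = toℕ≤n∸1 x₁
  coord≤ c₂ (_ , x₂ , _) = toℕ≤n∸1 x₂
  coord≤ c₃ (_ , _ , x₃) = toℕ≤n∸1 x₃

  corner-coord : ∀ {u : V} → IsCorner u → ∀ l → IsEnd (maxCoord l) (coord l u)
  corner-coord (e₁ , _ , _) c₁ = e₁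
  corner-coord (_ , e₂ , _) c₂ = e₂
  corner-coord (_ , _ , e₃) c₃ = e₃

  coord-ext : ∀ {p q : V} → (∀ l → coord l p ≡ coord l q) → p ≡ q
  coord-ext h =
    cong₂ _,_ (toℕ-injective (h c₁)) (cong₂ _,_ (toℕ-injective (h c₂)) (toℕ-injective (h c₃)))

  agreeOff-ext : ∀ {k} {p q : V} → coord k p ≡ coord k q → AgreeOff k p q → p ≡ q
  agreeOff-ext {k} e agree = coord-ext λ l → by-cover l (next-covers k l)
    where
    by-cover : ∀ l → l ≡ k ⊎ l ≡ next k ⊎ l ≡ next (next k) → coord l _ ≡ coord l _
    by-cover _ (inj₁ refl)        = e
    by-cover _ (inj₂ (inj₁ refl)) = agree (next k) (next≢ k)
    by-cover _ (inj₂ (inj₂ refl)) = agree (next (next k)) (next²≢ k)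

  agreeOff-from-cover : ∀ {i j k} {p q : V} → Covers i j k →
    coord i p ≡ coord i q → coord j p ≡ coord j q → AgreeOff k p q
  agreeOff-from-cover cover ei ej l l≢k with cover l
  ... | inj₁ refl        = ei
  ... | inj₂ (inj₁ refl) = ej
  ... | inj₂ (inj₂ refl) = ⊥-elim (l≢k refl)

  differ-only-in : ∀ {i j k} {p q : V} → Covers i j k → p ≢ q →
    coord i p ≡ coord i q → coord j p ≡ coord j q → coord k p ≢ coord k q × AgreeOff k p q
  differ-only-in cover p≢q ei ej = (λ ek → p≢q (agreeOff-ext ek p~q)) , p~q
    where p~q = agreeOff-from-cover cover ei ej

  distOff : Coord → V → V → ℕ
  distOff k p x =
    ∣ coord (next k) p - coord (next k) x ∣ + ∣ coord (next (next k)) p - coord (next (next k)) x ∣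

  dist-split : ∀ k (p x : V) → dist p x ≡ ∣ coord k p - coord k x ∣ + distOff k p x
  dist-split k p x = lemma k
    where
    d : Coord → ℕ
    d l = ∣ coord l p - coord l x ∣
    lemma : ∀ k → d c₁ + d c₂ + d c₃ ≡ d k + (d (next k) + d (next (next k)))
    lemma c₁ = +-assoc (d c₁) (d c₂) (d c₃)
    lemma c₂ = xy∙z≈y∙zx (d c₁) (d c₂) (d c₃)
    lemma c₃ = +-comm (d c₁ + d c₂) (d c₃)

  distOff-cong : ∀ {k} {p q x y : V} → AgreeOff k p q → AgreeOff k x y → distOff k p x ≡ distOff k q y
  distOff-cong {k} p~q x~y =
    cong₂ _+_ (cong₂ ∣_-_∣ (p~q _ (next≢ k)) (x~y _ (next≢ k)))
              (cong₂ ∣_-_∣ (p~q _ (next²≢ k)) (x~y _ (next²≢ k)))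

  unresolved-split : ∀ {k} {p w x y : V} → AgreeOff k p w → dist w x ≡ dist w y →
    ∣ coord k w - coord k x ∣ + distOff k p x ≡ ∣ coord k w - coord k y ∣ + distOff k p y
  unresolved-split {k} {p} {w} {x} {y} p~w e = begin
    ∣ coord k w - coord k x ∣ + distOff k p x  ≡⟨ cong (∣ coord k w - coord k x ∣ +_) (off x) ⟩
    ∣ coord k w - coord k x ∣ + distOff k w x  ≡⟨ dist-split k w x ⟨
    dist w x                                   ≡⟨ e ⟩
    dist w y                                   ≡⟨ dist-split k w y ⟩
    ∣ coord k w - coord k y ∣ + distOff k w y  ≡⟨ cong (∣ coord k w - coord k y ∣ +_) (off y) ⟨
    ∣ coord k w - coord k y ∣ + distOff k p y  ∎
    where
    open ≡-Reasoning
    off : ∀ z → distOff k p z ≡ distOff k w z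
    off z = distOff-cong {k} {p} {w} {z} {z} p~w λ _ _ → refl

  agreeOff-fixes : ∀ {k} {p x y : V} → IsEnd (maxCoord k) (coord k p) →
    AgreeOff k x y → dist p x ≡ dist p y → coord k x ≡ coord k y
  agreeOff-fixes {k} {p} {x} {y} end x~y e =
    ∣end-∣-injective end (coord≤ k x) (coord≤ k y) (+-cancelʳ-≡ (distOff k p y) _ _ (begin
      ∣ coord k p - coord k x ∣ + distOff k p y  ≡⟨ cong (∣ coord k p - coord k x ∣ +_) off ⟨
      ∣ coord k p - coord k x ∣ + distOff k p x  ≡⟨ unresolved-split {k} {p} {p} (λ _ _ → refl) e ⟩
      ∣ coord k p - coord k y ∣ + distOff k p y  ∎))
    where
    open ≡-Reasoning
    off : distOff k p x ≡ distOff k p y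
    off = distOff-cong {k} {p} {p} (λ _ _ → refl) x~y

  opposite-pair-fixes : ∀ {k} {p q x y : V} →
    IsEnd (maxCoord k) (coord k p) → IsEnd (maxCoord k) (coord k q) →
    coord k p ≢ coord k q → AgreeOff k p q →
    dist p x ≡ dist p y → dist q x ≡ dist q y → coord k x ≡ coord k y
  opposite-pair-fixes {k} {p} {q} {x} {y} end-p end-q p≢q p~q ep eq =
    ∣end-∣-injective end-p (coord≤ k x) (coord≤ k y)
      (≡-by-common-shift (unresolved-split {k} {p} {p} (λ _ _ → refl) ep) (unresolved-split {k} {p} {q} p~q eq)
        (trans (sum x) (sym (sum y))))
    where
    sum : ∀ z → ∣ coord k p - coord k z ∣ + ∣ coord k q - coord k z ∣ ≡ maxCoord k
    sum z = opposite-ends-sum end-p end-q p≢q (coord≤ k z)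

  OppositePairIn : Coord → List V → Set
  OppositePairIn k S = ∃₂ λ p q → p ∈ S × q ∈ S × coord k p ≢ coord k q × AgreeOff k p q

  unresolved-opposite-pair-fixes : ∀ {k S} {x y : V} → All IsCorner S → Unresolved S x y →
    OppositePairIn k S → coord k x ≡ coord k y
  unresolved-opposite-pair-fixes {k} corners eqs (_ , _ , p∈S , q∈S , p≢q , p~q) =
    opposite-pair-fixes (corner-coord (lookup corners p∈S) k) (corner-coord (lookup corners q∈S) k)
      p≢q p~q (lookup eqs p∈S) (lookup eqs q∈S)

  face-corners-opposite-pair : ∀ {i j k a} {u v w : V} → Covers i j k →
    IsCorner u → IsCorner v → IsCorner w → OnFace i a u → OnFace i a v → OnFace i a w →
    u ≢ v → u ≢ w → v ≢ w → OppositePairIn k (u ∷ v ∷ w ∷ [])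
  face-corners-opposite-pair {i} {j} {k} {u = u} {v} {w} cover cu cv cw fu fv fw u≢v u≢w v≢w
    with end-pigeonhole (corner-coord cu j) (corner-coord cv j) (corner-coord cw j)
  ... | inj₁ uv        = u , v , here refl , there (here refl) ,
                         differ-only-in cover u≢v (trans fu (sym fv)) uv
  ... | inj₂ (inj₁ uw) = u , w , here refl , there (there (here refl)) ,
                         differ-only-in cover u≢w (trans fu (sym fw)) uw
  ... | inj₂ (inj₂ vw) = v , w , there (here refl) , there (there (here refl)) ,
                         differ-only-in cover v≢w (trans fv (sym fw)) vw

  resolving-if-unresolved-equal : ∀ {S : List V} → (∀ x y → Unresolved S x y → x ≡ y) → IsResolving S
  resolving-if-unresolved-equal {S} h x y x≢y with all? (λ w → dist w x ≟ dist w y) S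
  ... | yes eqs = ⊥-elim (x≢y (h x y eqs))
  ... | no ¬eqs = find (¬All⇒Any¬ (λ w → dist w x ≟ dist w y) S ¬eqs)

  resolving-mono : ∀ {S S′ : List V} → S ⊆ S′ → IsResolving S → IsResolving S′
  resolving-mono S⊆S′ res x y x≢y with res x y x≢y
  ... | w , w∈S , r = w , S⊆S′ w∈S , r

  face-corners-resolving : ∀ i {a} {u v w : V} → IsCorner u → IsCorner v → IsCorner w →
    OnFace i a u → OnFace i a v → OnFace i a w → u ≢ v → u ≢ w → v ≢ w →
    IsResolving (u ∷ v ∷ w ∷ [])
  face-corners-resolving i {u = u} {v} {w} cu cv cw fu fv fw u≢v u≢w v≢w =
    resolving-if-unresolved-equal equal
    where
    equal : ∀ x y → Unresolved (u ∷ v ∷ w ∷ []) x y → x ≡ y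
    equal x y eqs@(eu ∷ _) = agreeOff-ext (agreeOff-fixes (corner-coord cu i) x~y eu) x~y
      where
      fix : ∀ {j k} → Covers i j k → coord k x ≡ coord k y
      fix cover = unresolved-opposite-pair-fixes (cu ∷ cv ∷ cw ∷ []) eqs
        (face-corners-opposite-pair cover cu cv cw fu fv fw u≢v u≢w v≢w)
      x~y : AgreeOff i x y
      x~y l l≢i with next-covers i l
      ... | inj₁ refl        = ⊥-elim (l≢i refl)
      ... | inj₂ (inj₁ refl) = fix (covers-swap (next-covers i))
      ... | inj₂ (inj₂ refl) = fix (next-covers i)

module _ {k₁ k₂ k₃ : ℕ} where

  private
    V : Set
    V = Vertex (suc (suc k₁)) (suc (suc k₂)) (suc (suc k₃))

  bitℕ : Bool → ℕ
  bitℕ false = 0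
  bitℕ true  = 1

  bit : ∀ {k} → Bool → Fin (suc (suc k))
  bit false = fzero
  bit true  = fsuc fzero

  square : Coord → Bool → Bool → V
  square c₁ s t = fzero , bit s , bit t
  square c₂ s t = bit t , fzero , bit s
  square c₃ s t = bit s , bit t , fzero

  square-≢ : ∀ i {s t} → square i true s ≢ square i false t
  square-≢ c₁ ()
  square-≢ c₂ ()
  square-≢ c₃ ()

  toℕ-bit : ∀ {k} s → toℕ (bit {k} s) ≡ bitℕ s
  toℕ-bit false = refl
  toℕ-bit true  = refl

  dist-square : ∀ i (a : V) s t → dist a (square i s t) ≡
    ∣ coord i a - 0 ∣ + (∣ coord (next i) a - bitℕ s ∣ + ∣ coord (next (next i)) a - bitℕ t ∣)
  dist-square c₁ a s t rewrite sym (toℕ-bit {k₂} s) | sym (toℕ-bit {k₃} t) = dist-split c₁ a (square c₁ s t)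
  dist-square c₂ a s t rewrite sym (toℕ-bit {k₃} s) | sym (toℕ-bit {k₁} t) = dist-split c₂ a (square c₂ s t)
  dist-square c₃ a s t rewrite sym (toℕ-bit {k₁} s) | sym (toℕ-bit {k₂} t) = dist-split c₃ a (square c₃ s t)

  same-pattern-unresolved : ∀ i (a : V) → (coord (next i) a ≡ᵇ 0) ≡ (coord (next (next i)) a ≡ᵇ 0) →
    dist a (square i true false) ≡ dist a (square i false true)
  same-pattern-unresolved i a e =
    trans (dist-square i a true false) (trans (cong (∣ coord i a - 0 ∣ +_) swap) (sym (dist-square i a false true)))
    where swap = swap-unit-same (coord (next i) a) (coord (next (next i)) a) e

  opposite-pattern-unresolved : ∀ i (a : V) →
    (coord (next i) a ≡ᵇ 0) ≡ not (coord (next (next i)) a ≡ᵇ 0) →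
    dist a (square i true true) ≡ dist a (square i false false)
  opposite-pattern-unresolved i a e =
    trans (dist-square i a true true) (trans (cong (∣ coord i a - 0 ∣ +_) swap) (sym (dist-square i a false false)))
    where swap = swap-unit-opposite (coord (next i) a) (coord (next (next i)) a) e

  unresolved-pair : (a b : V) → ∃₂ λ x y → x ≢ y × dist a x ≡ dist a y × dist b x ≡ dist b y
  unresolved-pair a b with adjacent-pigeonhole (λ l → (coord l a ≡ᵇ 0) xor (coord l b ≡ᵇ 0))
  ... | i , e with xor-agree _ _ _ _ e
  ... | inj₁ (ea , eb) = square i true false , square i false true , square-≢ i ,
                         same-pattern-unresolved i a ea , same-pattern-unresolved i b eb
  ... | inj₂ (ea , eb) = square i true true , square i false false , square-≢ i ,
                         opposite-pattern-unresolved i a ea , opposite-pattern-unresolved i b eb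

  pair-not-resolving : (a b : V) → ¬ IsResolving (a ∷ b ∷ [])
  pair-not-resolving a b res with unresolved-pair a b
  ... | x , y , x≢y , ea , eb with res x y x≢y
  ...   | _ , here refl , r         = r ea
  ...   | _ , there (here refl) , r = r eb

  origin : V
  origin = fzero , fzero , fzero

  resolving-length≥3 : (S : List V) → IsResolving S → 3 ≤ length S
  resolving-length≥3 []              res = ⊥-elim (pair-not-resolving origin origin (resolving-mono (λ ()) res))
  resolving-length≥3 (a ∷ [])        res =
    ⊥-elim (pair-not-resolving a a (resolving-mono (λ { (here refl) → here refl }) res))
  resolving-length≥3 (a ∷ b ∷ [])    res = ⊥-elim (pair-not-resolving a b res)
  resolving-length≥3 (_ ∷ _ ∷ _ ∷ _) _   = s≤s (s≤s (s≤s z≤n))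

  corner₁ : V
  corner₁ = fromℕ (suc k₁) , fzero , fzero

  corner₂ : V
  corner₂ = fzero , fromℕ (suc k₂) , fzero

  dimension-three : MetricDimensionIs (suc (suc k₁)) (suc (suc k₂)) (suc (suc k₃)) 3
  dimension-three =
    ( origin ∷ corner₁ ∷ corner₂ ∷ []
    , unique-triple (λ ()) (λ ()) (λ ())
    , face-corners-resolving c₃ origin-corner corner₁-corner corner₂-corner
        refl refl refl (λ ()) (λ ()) (λ ())
    , refl )
    , λ S _ → resolving-length≥3 S
    where
    origin-corner : IsCorner origin
    origin-corner = inj₁ refl , inj₁ refl , inj₁ refl
    corner₁-corner : IsCorner corner₁
    corner₁-corner = inj₂ (toℕ-fromℕ (suc k₁)) , inj₁ refl , inj₁ refl
    corner₂-corner : IsCorner corner₂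
    corner₂-corner = inj₁ refl , inj₂ (toℕ-fromℕ (suc k₂)) , inj₁ refl

-- The face value hypothesis is not needed: three corners on a common face already resolve.
theorem2 : (n₁ n₂ n₃ : ℕ) → n₁ ≥ 2 → n₂ ≥ 2 → n₃ ≥ 2 →
    MetricDimensionIs n₁ n₂ n₃ 3
    × ((i : Coord) (a : ℕ) → FaceValue n₁ n₂ n₃ i a →
       (u v w : Vertex n₁ n₂ n₃) →
       IsCorner u → IsCorner v → IsCorner w →
       OnFace i a u → OnFace i a v → OnFace i a w →
       u ≢ v → u ≢ w → v ≢ w →
       IsMetricBasis (u ∷ v ∷ w ∷ []))
theorem2 (suc (suc k₁)) (suc (suc k₂)) (suc (suc k₃)) (s≤s (s≤s _)) (s≤s (s≤s _)) (s≤s (s≤s _)) =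
  dimension-three , λ i _ _ _ _ _ cu cv cw fu fv fw u≢v u≢w v≢w →
    unique-triple u≢v u≢w v≢w , face-corners-resolving i cu cv cw fu fv fw u≢v u≢w v≢w , dimension-three
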